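{- As formal power series in $z,t$, $$\sum_{m\ge0}\sum_{k\ge0}T_{8\times m}(4,k)z^mt^k=\frac{1-z^2t-z^3t-z^4t^2+z^6t^3}{D(z,t)},$$ where $$D(z,t)=1-z-z^2t-4z^4t-2z^4t^2-z^5t^2+3z^6t^2+2z^6t^3+3z^7t^2+2z^7t^3+3z^8t^3+z^8t^4-3z^{10}t^4-z^{10}t^5.$$
   Context: $T_{n\times m}(s,k)$ denotes the number of tilings of an $n\times m$ rectangle (width $n$, length $m$, unit grid) by exactly $k$ non-overlapping grid-aligned $s\times s$ squares and $nm-ks^2$ unit squares, with rotations/reflections counted as distinct; for $m=0$ the only tiling is the empty one with $k=0$. -}

module Defs where

open import Data.Nat as ℕ using (ℕ; zero; suc; _∸_; _≤?_)
open import Data.Integer as ℤ using (ℤ; +_; -[1+_])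
open import Data.Bool using (Bool; true; false; _∧_; _∨_)
open import Data.Product using (_×_; _,_)
open import Data.List using (List; []; _∷_; map; concatMap; upTo; filterᵇ; length; foldr)
open import Relation.Nullary.Decidable using (⌊_⌋)

-- Tilings of an n × m rectangle by k s×s squares and unit squares.
--
-- A tiling is determined by the set of positions of its s×s squares
-- (the remaining cells are covered by unit squares in exactly one way).
-- A position (i , j) means the square occupies the cells
-- [i, i+s) × [j, j+s), with 0 ≤ i ≤ n - s (width direction) and
-- 0 ≤ j ≤ m - s (length direction).

Pos : Set
Pos = ℕ × ℕ

positions : (n m s : ℕ) → List Pos
positions n m s =
  concatMap (λ i → map (λ j → (i , j)) (upTo (suc m ∸ s))) (upTo (suc n ∸ s))

sublists : {A : Set} → List A → List (List A)
sublists []       = [] ∷ []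
sublists (x ∷ xs) = sublists xs Data.List.++ map (x ∷_) (sublists xs)

_≤ᵇ_ : ℕ → ℕ → Bool
a ≤ᵇ b = ⌊ a ≤? b ⌋

disjointᵇ : (s : ℕ) → Pos → Pos → Bool
disjointᵇ s (i , j) (i′ , j′) =
  ((i ℕ.+ s) ≤ᵇ i′) ∨ ((i′ ℕ.+ s) ≤ᵇ i) ∨ ((j ℕ.+ s) ≤ᵇ j′) ∨ ((j′ ℕ.+ s) ≤ᵇ j)

pairwiseDisjointᵇ : (s : ℕ) → List Pos → Bool
pairwiseDisjointᵇ s []       = true
pairwiseDisjointᵇ s (p ∷ ps) = allᵇ ps ∧ pairwiseDisjointᵇ s ps
  where
  allᵇ : List Pos → Bool
  allᵇ []       = true
  allᵇ (q ∷ qs) = disjointᵇ s p q ∧ allᵇ qs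

isTilingᵇ : (s k : ℕ) → List Pos → Bool
isTilingᵇ s k ps = ⌊ length ps ℕ.≟ k ⌋ ∧ pairwiseDisjointᵇ s ps

T : (n m s k : ℕ) → ℕ
T n m s k = length (filterᵇ (isTilingᵇ s k) (sublists (positions n m s)))

-- Formal power series in two variables z, t with integer coefficients:
-- f m k is the coefficient of z^m t^k.

FPS : Set
FPS = ℕ → ℕ → ℤ

sumTo : ℕ → (ℕ → ℤ) → ℤ
sumTo zero    f = f zero
sumTo (suc m) f = sumTo m f ℤ.+ f (suc m)

_⊛_ : FPS → FPS → FPS
(f ⊛ g) m k = sumTo m (λ a → sumTo k (λ b → f a b ℤ.* g (m ∸ a) (k ∸ b)))

-- polynomial given by a list of monomials (c , a , b) meaning c z^a t^b
poly : List (ℤ × ℕ × ℕ) → FPS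
poly ts m k =
  foldr (λ { (c , a , b) acc → (if ⌊ a ℕ.≟ m ⌋ ∧ ⌊ b ℕ.≟ k ⌋ then c else + 0) ℤ.+ acc })
        (+ 0) ts
  where open import Data.Bool using (if_then_else_)

F₈₄ : FPS
F₈₄ m k = + (T 8 m 4 k)

Num : FPS
Num = poly ((+ 1 , 0 , 0) ∷ (ℤ.- + 1 , 2 , 1) ∷ (ℤ.- + 1 , 3 , 1)
           ∷ (ℤ.- + 1 , 4 , 2) ∷ (+ 1 , 6 , 3) ∷ [])

Den : FPS
Den = poly ((+ 1 , 0 , 0) ∷ (ℤ.- + 1 , 1 , 0) ∷ (ℤ.- + 1 , 2 , 1)
           ∷ (ℤ.- + 4 , 4 , 1) ∷ (ℤ.- + 2 , 4 , 2) ∷ (ℤ.- + 1 , 5 , 2)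
           ∷ (+ 3 , 6 , 2) ∷ (+ 2 , 6 , 3) ∷ (+ 3 , 7 , 2) ∷ (+ 2 , 7 , 3)
           ∷ (+ 3 , 8 , 3) ∷ (+ 1 , 8 , 4) ∷ (ℤ.- + 3 , 10 , 4)
           ∷ (ℤ.- + 1 , 10 , 5) ∷ [])

module Submission where

open import Defs
open import Data.Nat using (ℕ)
open import Relation.Binary.PropositionalEquality using (_≡_)

open import Algebra.Bundles using (module CommutativeMonoid)
import Algebra.Properties.CommutativeSemigroup as CommSemigroupProperties
open import Data.Bool using (Bool; true; false; _∧_; _∨_; if_then_else_; not)
open import Data.Bool.ListAction using (all)
open import Data.Bool.Properties
  using (∧-identityʳ; ∧-zeroʳ; ∨-zeroʳ; ∨-comm; ∧-commutativeMonoid; ∨-commutativeMonoid)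
open import Data.Integer using (ℤ; +_; -_; -[1+_]; _+_; _*_; _-_)
import Data.Integer.Properties as ℤₚ
open import Data.List using (List; []; _∷_; _++_; map; concatMap; length; filterᵇ; upTo; applyUpTo)
open import Data.List.Properties
  using (filter-++; length-++; length-map; map-++; map-∘; map-applyUpTo; map-concatMap; concatMap-cong; ++-assoc)
  renaming (≡-dec to List-≡-dec)
open import Data.List.Relation.Binary.Permutation.Propositional
  using (_↭_; prep; swap; ↭-reflexive; module PermutationReasoning) renaming (refl to ↭-refl; trans to ↭-trans)
open import Data.List.Relation.Binary.Permutation.Propositional.Properties using (↭-length; ++⁺ˡ; map⁺; shifts)
open import Data.Nat as ℕ using (zero; suc; _∸_; _≤?_)
import Data.Nat.Properties as ℕₚ
open import Data.Product using (_×_; _,_)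
open import Data.Product.Properties using () renaming (≡-dec to ×-≡-dec)
open import Function using (_∘_; id)
open import Relation.Binary.PropositionalEquality using (refl; sym; trans; cong; cong₂; _≗_; module ≡-Reasoning)
open import Relation.Nullary.Decidable using (Dec; _because_; yes; no; ⌊_⌋; T?; _×-dec_; isYes≗does; dec-true)

-- A tiling is determined by its set of 4×4 squares, so T₈ₓₘ(4,k) counts the k-element
-- sets of pairwise disjoint square positions in the 8 × m strip.  Such counts obey
-- deletion–contraction (a position is either unused, or used and all positions meeting
-- it are discarded) and are invariant under translation.  Reading the strip column by
-- column, this gives a transfer system whose states are "frontiers": the pending
-- positions among the first four columns, followed by a strip of c further columns.
-- Writing the coefficient of z^(13+n) in Den·F as a combination of such states with n
-- kept symbolic and advancing the strip ten columns, everything cancels; for the finitely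
-- many smaller m the same computation runs down to the empty strip and yields Num.

private
  variable
    A B : Set

-- Counting sublists

length-filterᵇ-++ : ∀ (P : A → Bool) xs ys →
  length (filterᵇ P (xs ++ ys)) ≡ length (filterᵇ P xs) ℕ.+ length (filterᵇ P ys)
length-filterᵇ-++ P xs ys = trans (cong length (filter-++ (T? ∘ P) xs ys)) (length-++ (filterᵇ P xs))

length-filterᵇ-map : ∀ (P : B → Bool) (f : A → B) xs → length (filterᵇ P (map f xs)) ≡ length (filterᵇ (P ∘ f) xs)
length-filterᵇ-map P f []       = refl
length-filterᵇ-map P f (x ∷ xs) with P (f x)
... | true  = cong suc (length-filterᵇ-map P f xs)
... | false = length-filterᵇ-map P f xs

length-filterᵇ-cong : ∀ {P Q : A → Bool} → P ≗ Q → ∀ xs → length (filterᵇ P xs) ≡ length (filterᵇ Q xs)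
length-filterᵇ-cong             P≗Q []       = refl
length-filterᵇ-cong {P = P} {Q} P≗Q (x ∷ xs) with P x | Q x | P≗Q x
... | true  | .true  | refl = cong suc (length-filterᵇ-cong P≗Q xs)
... | false | .false | refl = length-filterᵇ-cong P≗Q xs

length-filterᵇ-none : ∀ (xs : List A) → length (filterᵇ (λ _ → false) xs) ≡ 0
length-filterᵇ-none []       = refl
length-filterᵇ-none (x ∷ xs) = length-filterᵇ-none xs

sublists-map : ∀ (f : A → B) xs → sublists (map f xs) ≡ map (map f) (sublists xs)
sublists-map f []       = refl
sublists-map f (x ∷ xs) = begin
  sublists (map f xs) ++ map (f x ∷_) (sublists (map f xs))
    ≡⟨ cong (λ S → S ++ map (f x ∷_) S) (sublists-map f xs) ⟩
  map (map f) S ++ map (f x ∷_) (map (map f) S)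
    ≡⟨ cong (map (map f) S ++_) (trans (sym (map-∘ S)) (map-∘ S)) ⟩
  map (map f) S ++ map (map f) (map (x ∷_) S)
    ≡⟨ sym (map-++ (map f) S _) ⟩
  map (map f) (S ++ map (x ∷_) S) ∎
  where
  open ≡-Reasoning
  S = sublists xs

countSublists : (List A → Bool) → List A → ℕ
countSublists P xs = length (filterᵇ P (sublists xs))

countSublists-∷ : ∀ P (x : A) xs → countSublists P (x ∷ xs) ≡ countSublists P xs ℕ.+ countSublists (P ∘ (x ∷_)) xs
countSublists-∷ P x xs = trans (length-filterᵇ-++ P (sublists xs) _)
                               (cong (countSublists P xs ℕ.+_) (length-filterᵇ-map P (x ∷_) (sublists xs)))

countSublists-cong : ∀ {P Q : List A → Bool} → P ≗ Q → ∀ xs → countSublists P xs ≡ countSublists Q xs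
countSublists-cong P≗Q xs = length-filterᵇ-cong P≗Q (sublists xs)

countSublists-none : ∀ (xs : List A) → countSublists (λ _ → false) xs ≡ 0
countSublists-none xs = length-filterᵇ-none (sublists xs)

countSublists-map : ∀ P (f : A → B) xs → countSublists P (map f xs) ≡ countSublists (P ∘ map f) xs
countSublists-map P f xs =
  trans (cong (length ∘ filterᵇ P) (sublists-map f xs)) (length-filterᵇ-map P (map f) (sublists xs))

Respects↭ : (List A → Bool) → Set _
Respects↭ P = ∀ {xs ys} → xs ↭ ys → P xs ≡ P ys

countSublists-↭ : ∀ {P : List A → Bool} → Respects↭ P →
                  ∀ {xs ys} → xs ↭ ys → countSublists P xs ≡ countSublists P ys
countSublists-↭ resp ↭-refl = refl
countSublists-↭ {P = P} resp (prep {xs} {ys} x p) = begin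
  # P (x ∷ xs)                ≡⟨ countSublists-∷ P x xs ⟩
  # P xs ℕ.+ # (P ∘ (x ∷_)) xs ≡⟨ cong₂ ℕ._+_ (countSublists-↭ resp p) (countSublists-↭ (resp ∘ prep x) p) ⟩
  # P ys ℕ.+ # (P ∘ (x ∷_)) ys ≡⟨ sym (countSublists-∷ P x ys) ⟩
  # P (x ∷ ys)                ∎
  where
  open ≡-Reasoning
  # = countSublists
countSublists-↭ {P = P} resp (swap {xs} {ys} x y p) = begin
  # P (x ∷ y ∷ xs)
    ≡⟨ trans (countSublists-∷ P x (y ∷ xs)) (cong₂ ℕ._+_ (countSublists-∷ P y xs) (countSublists-∷ Px y xs)) ⟩
  (# P xs ℕ.+ # Py xs) ℕ.+ (# Px xs ℕ.+ # Pxy xs)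
    ≡⟨ interchange (# P xs) _ _ _ ⟩
  (# P xs ℕ.+ # Px xs) ℕ.+ (# Py xs ℕ.+ # Pxy xs)
    ≡⟨ cong₂ ℕ._+_ (cong₂ ℕ._+_ (countSublists-↭ resp p) (countSublists-↭ (resp ∘ prep x) p))
                   (cong₂ ℕ._+_ (countSublists-↭ (resp ∘ prep y) p) (countSublists-↭ (resp ∘ prep x ∘ prep y) p)) ⟩
  (# P ys ℕ.+ # Px ys) ℕ.+ (# Py ys ℕ.+ # Pxy ys)
    ≡⟨ cong (λ n → (# P ys ℕ.+ # Px ys) ℕ.+ (# Py ys ℕ.+ n))
            (countSublists-cong (λ _ → resp (swap x y ↭-refl)) ys) ⟩
  (# P ys ℕ.+ # Px ys) ℕ.+ (# Py ys ℕ.+ # Pyx ys)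
    ≡⟨ sym (trans (countSublists-∷ P y (x ∷ ys)) (cong₂ ℕ._+_ (countSublists-∷ P x ys) (countSublists-∷ Py x ys))) ⟩
  # P (y ∷ x ∷ ys) ∎
  where
  open ≡-Reasoning
  open CommSemigroupProperties ℕₚ.+-commutativeSemigroup using (interchange)
  # = countSublists
  Px = P ∘ (x ∷_)
  Py = P ∘ (y ∷_)
  Pxy = P ∘ (x ∷_) ∘ (y ∷_)
  Pyx = P ∘ (y ∷_) ∘ (x ∷_)
countSublists-↭ resp (↭-trans p q) = trans (countSublists-↭ resp p) (countSublists-↭ resp q)

all-↭ : ∀ (d : A → Bool) → Respects↭ (all d)
all-↭ d ↭-refl        = refl
all-↭ d (prep x p)    = cong (d x ∧_) (all-↭ d p)
all-↭ d (swap x y p)  = trans (cong (λ b → d x ∧ (d y ∧ b)) (all-↭ d p)) (x∙yz≈y∙xz (d x) (d y) _)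
  where open CommSemigroupProperties (CommutativeMonoid.commutativeSemigroup ∧-commutativeMonoid) using (x∙yz≈y∙xz)
all-↭ d (↭-trans p q) = trans (all-↭ d p) (all-↭ d q)

countSublists-all : ∀ (d : A → Bool) Q xs →
  countSublists (λ ys → all d ys ∧ Q ys) xs ≡ countSublists Q (filterᵇ d xs)
countSublists-all d Q [] with Q []
... | true  = refl
... | false = refl
countSublists-all d Q (y ∷ xs) with d y in dy
... | true = begin
  # (λ ys → all d ys ∧ Q ys) (y ∷ xs)
    ≡⟨ countSublists-∷ _ y xs ⟩
  # (λ ys → all d ys ∧ Q ys) xs ℕ.+ # (λ ys → (d y ∧ all d ys) ∧ Q (y ∷ ys)) xs
    ≡⟨ cong₂ ℕ._+_ (countSublists-all d Q xs)
                   (trans (countSublists-cong (λ ys → cong (λ b → (b ∧ all d ys) ∧ Q (y ∷ ys)) dy) xs)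
                          (countSublists-all d (Q ∘ (y ∷_)) xs)) ⟩
  # Q (filterᵇ d xs) ℕ.+ # (Q ∘ (y ∷_)) (filterᵇ d xs)
    ≡⟨ sym (countSublists-∷ Q y (filterᵇ d xs)) ⟩
  # Q (y ∷ filterᵇ d xs) ∎
  where
  open ≡-Reasoning
  # = countSublists
... | false = begin
  # (λ ys → all d ys ∧ Q ys) (y ∷ xs)
    ≡⟨ countSublists-∷ _ y xs ⟩
  # (λ ys → all d ys ∧ Q ys) xs ℕ.+ # (λ ys → (d y ∧ all d ys) ∧ Q (y ∷ ys)) xs
    ≡⟨ cong₂ ℕ._+_ (countSublists-all d Q xs)
                   (trans (countSublists-cong (λ ys → cong (λ b → (b ∧ all d ys) ∧ Q (y ∷ ys)) dy) xs)
                          (countSublists-none xs)) ⟩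
  # Q (filterᵇ d xs) ℕ.+ 0
    ≡⟨ ℕₚ.+-identityʳ _ ⟩
  # Q (filterᵇ d xs) ∎
  where
  open ≡-Reasoning
  # = countSublists

-- Packings of s×s squares

⌊suc≟suc⌋ : ∀ a b → ⌊ suc a ℕ.≟ suc b ⌋ ≡ ⌊ a ℕ.≟ b ⌋
⌊suc≟suc⌋ a b = trans (isYes≗does (suc a ℕ.≟ suc b)) (sym (isYes≗does (a ℕ.≟ b)))

suc≤ᵇsuc : ∀ a b → (suc a ℕ.≤ᵇ suc b) ≡ (a ℕ.≤ᵇ b)
suc≤ᵇsuc zero    b = refl
suc≤ᵇsuc (suc a) b = refl

⌊suc≤?suc⌋ : ∀ a b → ⌊ suc a ≤? suc b ⌋ ≡ ⌊ a ≤? b ⌋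
⌊suc≤?suc⌋ a b = trans (isYes≗does (suc a ≤? suc b)) (trans (suc≤ᵇsuc a b) (sym (isYes≗does (a ≤? b))))

module _ (s : ℕ) where

  disjointᵇ-sym : ∀ p q → disjointᵇ s p q ≡ disjointᵇ s q p
  disjointᵇ-sym (i , j) (i′ , j′) = trans (x∙yz≈y∙xz ((i ℕ.+ s) ≤ᵇ i′) ((i′ ℕ.+ s) ≤ᵇ i) _)
    (cong (λ b → ((i′ ℕ.+ s) ≤ᵇ i) ∨ ((i ℕ.+ s) ≤ᵇ i′) ∨ b) (∨-comm ((j ℕ.+ s) ≤ᵇ j′) _))
    where open CommSemigroupProperties (CommutativeMonoid.commutativeSemigroup ∨-commutativeMonoid) using (x∙yz≈y∙xz)

  -- The conjunction over ps inside pairwiseDisjointᵇ is local to its where block, so it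
  -- can only be compared with all through the conjunct it occurs in.
  pairwiseDisjointᵇ-∷ : ∀ p ps → pairwiseDisjointᵇ s (p ∷ ps) ≡ all (disjointᵇ s p) ps ∧ pairwiseDisjointᵇ s ps
  pairwiseDisjointᵇ-∷ p []       = refl
  pairwiseDisjointᵇ-∷ p (q ∷ qs) = guarded (disjointᵇ s p q) _ (pairwiseDisjointᵇ s qs) (pairwiseDisjointᵇ-∷ p qs)
    where
    guarded : ∀ {a a′} d b w → a ∧ w ≡ a′ ∧ w → (d ∧ a) ∧ (b ∧ w) ≡ (d ∧ a′) ∧ (b ∧ w)
    guarded {a} {a′} d b true  eq =
      cong (λ x → (d ∧ x) ∧ (b ∧ true)) (trans (sym (∧-identityʳ a)) (trans eq (∧-identityʳ a′)))
    guarded {a} {a′} d b false _ rewrite ∧-zeroʳ b | ∧-zeroʳ (d ∧ a) | ∧-zeroʳ (d ∧ a′) = refl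

  pairwiseDisjointᵇ-↭ : Respects↭ (pairwiseDisjointᵇ s)
  pairwiseDisjointᵇ-↭ ↭-refl = refl
  pairwiseDisjointᵇ-↭ (prep {xs} {ys} x p) = begin
    pairwiseDisjointᵇ s (x ∷ xs)          ≡⟨ pairwiseDisjointᵇ-∷ x xs ⟩
    all (D x) xs ∧ pairwiseDisjointᵇ s xs ≡⟨ cong₂ _∧_ (all-↭ (D x) p) (pairwiseDisjointᵇ-↭ p) ⟩
    all (D x) ys ∧ pairwiseDisjointᵇ s ys ≡⟨ sym (pairwiseDisjointᵇ-∷ x ys) ⟩
    pairwiseDisjointᵇ s (x ∷ ys)          ∎
    where
    open ≡-Reasoning
    D = disjointᵇ s
  pairwiseDisjointᵇ-↭ (swap {xs} {ys} x y p) = begin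
    pairwiseDisjointᵇ s (x ∷ y ∷ xs)
      ≡⟨ trans (pairwiseDisjointᵇ-∷ x (y ∷ xs)) (cong ((D x y ∧ all (D x) xs) ∧_) (pairwiseDisjointᵇ-∷ y xs)) ⟩
    (D x y ∧ all (D x) xs) ∧ (all (D y) xs ∧ pairwiseDisjointᵇ s xs)
      ≡⟨ interchange (D x y) _ _ _ ⟩
    (D x y ∧ all (D y) xs) ∧ (all (D x) xs ∧ pairwiseDisjointᵇ s xs)
      ≡⟨ cong₂ _∧_ (cong₂ _∧_ (disjointᵇ-sym x y) (all-↭ (D y) p))
                   (cong₂ _∧_ (all-↭ (D x) p) (pairwiseDisjointᵇ-↭ p)) ⟩
    (D y x ∧ all (D y) ys) ∧ (all (D x) ys ∧ pairwiseDisjointᵇ s ys)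
      ≡⟨ sym (trans (pairwiseDisjointᵇ-∷ y (x ∷ ys))
                    (cong ((D y x ∧ all (D y) ys) ∧_) (pairwiseDisjointᵇ-∷ x ys))) ⟩
    pairwiseDisjointᵇ s (y ∷ x ∷ ys) ∎
    where
    open ≡-Reasoning
    open CommSemigroupProperties (CommutativeMonoid.commutativeSemigroup ∧-commutativeMonoid) using (interchange)
    D = disjointᵇ s
  pairwiseDisjointᵇ-↭ (↭-trans p q) = trans (pairwiseDisjointᵇ-↭ p) (pairwiseDisjointᵇ-↭ q)

  pairwiseDisjointᵇ-map : ∀ (f : Pos → Pos) → (∀ p q → disjointᵇ s (f p) (f q) ≡ disjointᵇ s p q) →
                          ∀ ps → pairwiseDisjointᵇ s (map f ps) ≡ pairwiseDisjointᵇ s ps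
  pairwiseDisjointᵇ-map f f-disjoint []       = refl
  pairwiseDisjointᵇ-map f f-disjoint (p ∷ ps) = begin
    pairwiseDisjointᵇ s (f p ∷ map f ps)
      ≡⟨ pairwiseDisjointᵇ-∷ (f p) (map f ps) ⟩
    all (disjointᵇ s (f p)) (map f ps) ∧ pairwiseDisjointᵇ s (map f ps)
      ≡⟨ cong₂ _∧_ (all-map ps) (pairwiseDisjointᵇ-map f f-disjoint ps) ⟩
    all (disjointᵇ s p) ps ∧ pairwiseDisjointᵇ s ps
      ≡⟨ sym (pairwiseDisjointᵇ-∷ p ps) ⟩
    pairwiseDisjointᵇ s (p ∷ ps) ∎
    where
    open ≡-Reasoning
    all-map : ∀ qs → all (disjointᵇ s (f p)) (map f qs) ≡ all (disjointᵇ s p) qs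
    all-map []       = refl
    all-map (q ∷ qs) = cong₂ _∧_ (f-disjoint p q) (all-map qs)

  packings : List Pos → ℕ → ℕ
  packings ps k = countSublists (isTilingᵇ s k) ps

  packings-↭ : ∀ {ps qs} → ps ↭ qs → ∀ k → packings ps k ≡ packings qs k
  packings-↭ p k =
    countSublists-↭ (λ q → cong₂ (λ n b → ⌊ n ℕ.≟ k ⌋ ∧ b) (↭-length q) (pairwiseDisjointᵇ-↭ q)) p

  packings-map : ∀ (f : Pos → Pos) → (∀ p q → disjointᵇ s (f p) (f q) ≡ disjointᵇ s p q) →
                 ∀ ps k → packings (map f ps) k ≡ packings ps k
  packings-map f f-disjoint ps k = trans (countSublists-map (isTilingᵇ s k) f ps) (countSublists-cong
    (λ qs → cong₂ (λ n b → ⌊ n ℕ.≟ k ⌋ ∧ b) (length-map f qs) (pairwiseDisjointᵇ-map f f-disjoint qs)) ps)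

  packings-∷-zero : ∀ p ps → packings (p ∷ ps) 0 ≡ packings ps 0
  packings-∷-zero p ps = trans (countSublists-∷ (isTilingᵇ s 0) p ps)
                               (trans (cong (packings ps 0 ℕ.+_) (countSublists-none ps)) (ℕₚ.+-identityʳ _))

  packings-∷-suc : ∀ p ps k →
    packings (p ∷ ps) (suc k) ≡ packings ps (suc k) ℕ.+ packings (filterᵇ (disjointᵇ s p) ps) k
  packings-∷-suc p ps k = trans (countSublists-∷ (isTilingᵇ s (suc k)) p ps) (cong (packings ps (suc k) ℕ.+_)
    (trans (countSublists-cong containing-p ps) (countSublists-all (disjointᵇ s p) (isTilingᵇ s k) ps)))
    where
    open CommSemigroupProperties (CommutativeMonoid.commutativeSemigroup ∧-commutativeMonoid) using (x∙yz≈y∙xz)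
    containing-p : ∀ ys → isTilingᵇ s (suc k) (p ∷ ys) ≡ all (disjointᵇ s p) ys ∧ isTilingᵇ s k ys
    containing-p ys = trans (cong₂ _∧_ (⌊suc≟suc⌋ (length ys) k) (pairwiseDisjointᵇ-∷ p ys))
                            (x∙yz≈y∙xz ⌊ length ys ℕ.≟ k ⌋ (all (disjointᵇ s p) ys) (pairwiseDisjointᵇ s ys))

-- The 8 × m strip, column by column

right : Pos → Pos
right (i , j) = i , suc j

rightBy : ℕ → Pos → Pos
rightBy d (i , j) = i , d ℕ.+ j

left : Pos → Pos
left (i , j) = i , ℕ.pred j

inColumn0 : Pos → Bool
inColumn0 (_ , j) = j ℕ.≡ᵇ 0

right∘left : ∀ ps → all (not ∘ inColumn0) ps ≡ true → map right (map left ps) ≡ ps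
right∘left []                 _ = refl
right∘left ((i , suc j) ∷ ps) h = cong ((i , suc j) ∷_) (right∘left ps h)

disjointᵇ-right : ∀ s p q → disjointᵇ s (right p) (right q) ≡ disjointᵇ s p q
disjointᵇ-right s (i , j) (i′ , j′) = cong (λ b → ((i ℕ.+ s) ≤ᵇ i′) ∨ ((i′ ℕ.+ s) ≤ᵇ i) ∨ b)
  (cong₂ _∨_ (⌊suc≤?suc⌋ (j ℕ.+ s) j′) (⌊suc≤?suc⌋ (j′ ℕ.+ s) j))

disjointᵇ-rightBy : ∀ s d p q → disjointᵇ s (rightBy d p) (rightBy d q) ≡ disjointᵇ s p q
disjointᵇ-rightBy s zero    p q = refl
disjointᵇ-rightBy s (suc d) p q = trans (disjointᵇ-right s (rightBy d p) (rightBy d q)) (disjointᵇ-rightBy s d p q)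

disjointᵇ-column0-rightBy : ∀ s i q → disjointᵇ s (i , 0) (rightBy s q) ≡ true
disjointᵇ-column0-rightBy s i (i′ , j′) =
  trans (cong (λ b → above ∨ below ∨ b ∨ right-of) left-of)
        (trans (cong (above ∨_) (∨-zeroʳ below)) (∨-zeroʳ above))
  where
  above = (i ℕ.+ s) ≤ᵇ i′
  below = (i′ ℕ.+ s) ≤ᵇ i
  right-of = (s ℕ.+ j′ ℕ.+ s) ≤ᵇ 0
  left-of : (0 ℕ.+ s) ≤ᵇ (s ℕ.+ j′) ≡ true
  left-of = trans (isYes≗does (s ≤? s ℕ.+ j′)) (dec-true (s ≤? s ℕ.+ j′) (ℕₚ.m≤m+n s j′))

concatMap-∷-↭ : ∀ (f : A → B) (g : A → List B) xs → concatMap (λ x → f x ∷ g x) xs ↭ map f xs ++ concatMap g xs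
concatMap-∷-↭ f g []       = ↭-refl
concatMap-∷-↭ f g (x ∷ xs) = prep (f x) (↭-trans (++⁺ˡ (g x) (concatMap-∷-↭ f g xs)) (shifts (g x) (map f xs)))

rowMajor : List ℕ → ℕ → List Pos
rowMajor is c = concatMap (λ i → map (i ,_) (upTo c)) is

columnMajor : List ℕ → ℕ → List Pos
columnMajor is zero    = []
columnMajor is (suc c) = map (_, 0) is ++ map right (columnMajor is c)

rowMajor↭columnMajor : ∀ is c → rowMajor is c ↭ columnMajor is c
rowMajor↭columnMajor is zero    = ↭-reflexive (no-columns is)
  where
  no-columns : ∀ is → rowMajor is 0 ≡ []
  no-columns []       = refl
  no-columns (i ∷ is) = no-columns is
rowMajor↭columnMajor is (suc c) = begin
  concatMap (λ i → (i , 0) ∷ map (i ,_) (applyUpTo suc c)) is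
    ≡⟨ concatMap-cong (λ i → cong ((i , 0) ∷_) (row-suc i)) is ⟩
  concatMap (λ i → (i , 0) ∷ map right (map (i ,_) (upTo c))) is
    ↭⟨ concatMap-∷-↭ (_, 0) (λ i → map right (map (i ,_) (upTo c))) is ⟩
  map (_, 0) is ++ concatMap (λ i → map right (map (i ,_) (upTo c))) is
    ≡⟨ cong (map (_, 0) is ++_) (sym (map-concatMap right (λ i → map (i ,_) (upTo c)) is)) ⟩
  map (_, 0) is ++ map right (rowMajor is c)
    ↭⟨ ++⁺ˡ (map (_, 0) is) (map⁺ right (rowMajor↭columnMajor is c)) ⟩
  map (_, 0) is ++ map right (columnMajor is c) ∎
  where
  open PermutationReasoning
  row-suc : ∀ i → map (i ,_) (applyUpTo suc c) ≡ map right (map (i ,_) (upTo c))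
  row-suc i = trans (map-applyUpTo suc (i ,_) c) (sym (trans (sym (map-∘ (upTo c))) (map-applyUpTo id (right ∘ (i ,_)) c)))

strip : ℕ → List Pos
strip = columnMajor (upTo 5)

column : ℕ → List Pos
column j = map (_, j) (upTo 5)

-- The strip is moved four columns to the right so that columns 0–3 can hold a frontier.
grid : ℕ → List Pos
grid c = map (rightBy 4) (strip c)

-- Here positions 8 m 4 is rowMajor (upTo 5) (suc m ∸ 4) by definition.
T-as-packings : ∀ m k → T 8 m 4 k ≡ packings 4 (grid (suc m ∸ 4)) k
T-as-packings m k = trans (packings-↭ 4 (rowMajor↭columnMajor (upTo 5) (suc m ∸ 4)) k)
                          (sym (packings-map 4 (rightBy 4) (disjointᵇ-rightBy 4 4) (strip (suc m ∸ 4)) k))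

filter-column0-grid : ∀ x → inColumn0 x ≡ true → ∀ c → filterᵇ (disjointᵇ 4 x) (grid c) ≡ grid c
filter-column0-grid (i , zero) _ c = go (strip c)
  where
  go : ∀ ps → filterᵇ (disjointᵇ 4 (i , 0)) (map (rightBy 4) ps) ≡ map (rightBy 4) ps
  go []       = refl
  go (p ∷ ps) rewrite disjointᵇ-column0-rightBy 4 i p = cong (rightBy 4 p ∷_) (go ps)

-- Series in t and products with polynomials

shiftBy : ℕ → (ℕ → ℤ) → ℕ → ℤ
shiftBy zero    f k       = f k
shiftBy (suc e) f zero    = + 0
shiftBy (suc e) f (suc k) = shiftBy e f k

shiftBy-cong : ∀ e {f g} → f ≗ g → shiftBy e f ≗ shiftBy e g
shiftBy-cong zero    f≗g k       = f≗g k
shiftBy-cong (suc e) f≗g zero    = refl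
shiftBy-cong (suc e) f≗g (suc k) = shiftBy-cong e f≗g k

shiftBy-+ : ∀ e f g k → shiftBy e (λ k′ → f k′ + g k′) k ≡ shiftBy e f k + shiftBy e g k
shiftBy-+ zero    f g k       = refl
shiftBy-+ (suc e) f g zero    = refl
shiftBy-+ (suc e) f g (suc k) = shiftBy-+ e f g k

shiftBy-suc : ∀ e g k → shiftBy e (shiftBy 1 g) k ≡ shiftBy (suc e) g k
shiftBy-suc zero    g k       = refl
shiftBy-suc (suc e) g zero    = refl
shiftBy-suc (suc e) g (suc k) = shiftBy-suc e g k

*-shiftBy : ∀ c e g k → c * shiftBy e g k ≡ (if e ℕ.≤ᵇ k then c * g (k ∸ e) else + 0)
*-shiftBy c zero    g k       = refl
*-shiftBy c (suc e) g zero    = ℤₚ.*-zeroʳ c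
*-shiftBy c (suc e) g (suc k) =
  trans (*-shiftBy c e g k) (cong (λ p → if p then c * g (k ∸ e) else + 0) (sym (suc≤ᵇsuc e k)))

sumTo-cong : ∀ n {f g : ℕ → ℤ} → f ≗ g → sumTo n f ≡ sumTo n g
sumTo-cong zero    f≗g = f≗g 0
sumTo-cong (suc n) f≗g = cong₂ _+_ (sumTo-cong n f≗g) (f≗g (suc n))

sumTo-+ : ∀ n (f g : ℕ → ℤ) → sumTo n (λ x → f x + g x) ≡ sumTo n f + sumTo n g
sumTo-+ zero    f g = refl
sumTo-+ (suc n) f g = trans (cong (_+ (f (suc n) + g (suc n))) (sumTo-+ n f g)) (interchange (sumTo n f) _ _ _)
  where open CommSemigroupProperties ℤₚ.+-commutativeSemigroup using (interchange)

sumTo-zero : ∀ n → sumTo n (λ _ → + 0) ≡ + 0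
sumTo-zero zero    = refl
sumTo-zero (suc n) = cong (_+ + 0) (sumTo-zero n)

sumTo-suc : ∀ n (f : ℕ → ℤ) → sumTo (suc n) f ≡ f 0 + sumTo n (f ∘ suc)
sumTo-suc zero    f = refl
sumTo-suc (suc n) f = trans (cong (_+ f (suc (suc n))) (sumTo-suc n f)) (ℤₚ.+-assoc (f 0) _ _)

sumTo-if : ∀ n p (f : ℕ → ℤ) → sumTo n (λ x → if p then f x else + 0) ≡ (if p then sumTo n f else + 0)
sumTo-if n true  f = refl
sumTo-if n false f = sumTo-zero n

sumTo-δ : ∀ n a (f : ℕ → ℤ) →
  sumTo n (λ x → if ⌊ a ℕ.≟ x ⌋ then f x else + 0) ≡ (if a ℕ.≤ᵇ n then f a else + 0)
sumTo-δ zero    zero    f = refl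
sumTo-δ zero    (suc a) f = refl
sumTo-δ (suc n) zero    f = trans (sumTo-suc n _) (trans (cong (λ z → f 0 + z) (sumTo-zero n)) (ℤₚ.+-identityʳ _))
sumTo-δ (suc n) (suc a) f = begin
  sumTo (suc n) (λ x → if ⌊ suc a ℕ.≟ x ⌋ then f x else + 0)
    ≡⟨ trans (sumTo-suc n _) (ℤₚ.+-identityˡ _) ⟩
  sumTo n (λ x → if ⌊ suc a ℕ.≟ suc x ⌋ then f (suc x) else + 0)
    ≡⟨ sumTo-cong n (λ x → cong (λ b → if b then f (suc x) else + 0) (⌊suc≟suc⌋ a x)) ⟩
  sumTo n (λ x → if ⌊ a ℕ.≟ x ⌋ then f (suc x) else + 0)
    ≡⟨ sumTo-δ n a (f ∘ suc) ⟩
  (if a ℕ.≤ᵇ n then f (suc a) else + 0)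
    ≡⟨ cong (λ b → if b then f (suc a) else + 0) (sym (suc≤ᵇsuc a n)) ⟩
  (if suc a ℕ.≤ᵇ suc n then f (suc a) else + 0) ∎
  where open ≡-Reasoning

polyAction : List (ℤ × ℕ × ℕ) → FPS → FPS
polyAction []                G m k = + 0
polyAction ((c , a , b) ∷ P) G m k = (if a ℕ.≤ᵇ m then c * shiftBy b (G (m ∸ a)) k else + 0) + polyAction P G m k

monomial-⊛ : ∀ c a b (G : FPS) m k →
  sumTo m (λ a′ → sumTo k (λ b′ → (if ⌊ a ℕ.≟ a′ ⌋ ∧ ⌊ b ℕ.≟ b′ ⌋ then c else + 0) * G (m ∸ a′) (k ∸ b′)))
  ≡ (if a ℕ.≤ᵇ m then c * shiftBy b (G (m ∸ a)) k else + 0)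
monomial-⊛ c a b G m k = begin
  sumTo m (λ a′ → sumTo k (λ b′ → (if ⌊ a ℕ.≟ a′ ⌋ ∧ ⌊ b ℕ.≟ b′ ⌋ then c else + 0) * G (m ∸ a′) (k ∸ b′)))
    ≡⟨ sumTo-cong m (λ a′ → trans (sumTo-cong k (λ b′ → split ⌊ a ℕ.≟ a′ ⌋ ⌊ b ℕ.≟ b′ ⌋ (G (m ∸ a′) (k ∸ b′))))
                                  (sumTo-if k ⌊ a ℕ.≟ a′ ⌋ (λ b′ → if ⌊ b ℕ.≟ b′ ⌋ then c * G (m ∸ a′) (k ∸ b′)
                                                                                 else + 0))) ⟩
  sumTo m (λ a′ → if ⌊ a ℕ.≟ a′ ⌋ then inner a′ else + 0)
    ≡⟨ sumTo-δ m a inner ⟩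
  (if a ℕ.≤ᵇ m then inner a else + 0)
    ≡⟨ cong (λ z → if a ℕ.≤ᵇ m then z else + 0)
            (trans (sumTo-δ k b (λ b′ → c * G (m ∸ a) (k ∸ b′))) (sym (*-shiftBy c b (G (m ∸ a)) k))) ⟩
  (if a ℕ.≤ᵇ m then c * shiftBy b (G (m ∸ a)) k else + 0) ∎
  where
  open ≡-Reasoning
  inner : ℕ → ℤ
  inner a′ = sumTo k (λ b′ → if ⌊ b ℕ.≟ b′ ⌋ then c * G (m ∸ a′) (k ∸ b′) else + 0)
  split : ∀ p q z → (if p ∧ q then c else + 0) * z ≡ (if p then (if q then c * z else + 0) else + 0)
  split true  true  z = refl
  split true  false z = refl
  split false q     z = refl

poly-⊛ : ∀ P (G : FPS) m k → (poly P ⊛ G) m k ≡ polyAction P G m k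
poly-⊛ []                G m k = trans (sumTo-cong m (λ _ → sumTo-zero k)) (sumTo-zero m)
poly-⊛ ((c , a , b) ∷ P) G m k = begin
  sumTo m (λ a′ → sumTo k (λ b′ → (δ a′ b′ + poly P a′ b′) * G′ a′ b′))
    ≡⟨ sumTo-cong m (λ a′ → trans (sumTo-cong k (λ b′ → ℤₚ.*-distribʳ-+ (G′ a′ b′) (δ a′ b′) _))
                                  (sumTo-+ k (λ b′ → δ a′ b′ * G′ a′ b′) (λ b′ → poly P a′ b′ * G′ a′ b′))) ⟩
  sumTo m (λ a′ → sumTo k (λ b′ → δ a′ b′ * G′ a′ b′) + sumTo k (λ b′ → poly P a′ b′ * G′ a′ b′))
    ≡⟨ sumTo-+ m (λ a′ → sumTo k (λ b′ → δ a′ b′ * G′ a′ b′))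
                 (λ a′ → sumTo k (λ b′ → poly P a′ b′ * G′ a′ b′)) ⟩
  sumTo m (λ a′ → sumTo k (λ b′ → δ a′ b′ * G′ a′ b′)) + (poly P ⊛ G) m k
    ≡⟨ cong₂ _+_ (monomial-⊛ c a b G m k) (poly-⊛ P G m k) ⟩
  polyAction ((c , a , b) ∷ P) G m k ∎
  where
  open ≡-Reasoning
  δ G′ : ℕ → ℕ → ℤ
  δ a′ b′ = if ⌊ a ℕ.≟ a′ ⌋ ∧ ⌊ b ℕ.≟ b′ ⌋ then c else + 0
  G′ a′ b′ = G (m ∸ a′) (k ∸ b′)

-- Transfer terms

packingSeries : List Pos → ℕ → ℕ → ℤ
packingSeries Q c k = + packings 4 (Q ++ grid c) k

packingSeries-∷ : ∀ x Q c → filterᵇ (disjointᵇ 4 x) (grid c) ≡ grid c →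
  ∀ k → packingSeries (x ∷ Q) c k ≡ packingSeries Q c k + shiftBy 1 (packingSeries (filterᵇ (disjointᵇ 4 x) Q) c) k
packingSeries-∷ x Q c isolated zero    = trans (cong +_ (packings-∷-zero 4 x (Q ++ grid c))) (sym (ℤₚ.+-identityʳ _))
packingSeries-∷ x Q c isolated (suc k) = cong +_ (trans (packings-∷-suc 4 x (Q ++ grid c) k)
  (cong (λ ps → packings 4 (Q ++ grid c) (suc k) ℕ.+ packings 4 ps k)
        (trans (filter-++ (T? ∘ disjointᵇ 4 x) Q (grid c)) (cong (filterᵇ (disjointᵇ 4 x) Q ++_) isolated))))

packingSeries-advance : ∀ Q c → all (not ∘ inColumn0) Q ≡ true →
  packingSeries Q (suc c) ≗ packingSeries (map left Q ++ column 3) c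
packingSeries-advance Q c h k = cong +_ (trans (cong (λ ps → packings 4 ps k) (sym shifted))
  (packings-map 4 right (disjointᵇ-right 4) ((map left Q ++ column 3) ++ grid c) k))
  where
  open ≡-Reasoning
  shifted : map right ((map left Q ++ column 3) ++ grid c) ≡ Q ++ grid (suc c)
  shifted = begin
    map right ((map left Q ++ column 3) ++ grid c)
      ≡⟨ trans (map-++ right (map left Q ++ column 3) (grid c))
               (cong (_++ map right (grid c)) (map-++ right (map left Q) (column 3))) ⟩
    (map right (map left Q) ++ column 4) ++ map right (grid c)
      ≡⟨ ++-assoc (map right (map left Q)) (column 4) _ ⟩
    map right (map left Q) ++ column 4 ++ map right (grid c)
      ≡⟨ cong₂ (λ ps qs → ps ++ column 4 ++ qs) (right∘left Q h) (trans (sym (map-∘ (strip c))) (map-∘ (strip c))) ⟩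
    Q ++ grid (suc c) ∎

-- At level n, term c e Q w stands for c · tᵉ · packingSeries Q (w + n).  Keeping the
-- level symbolic lets one finite computation on terms treat all strip lengths at once.
record Term : Set where
  constructor term
  field
    coeff    : ℤ
    tExp     : ℕ
    frontier : List Pos
    width    : ℕ

open Term

⟦_⟧ : Term → ℕ → ℕ → ℤ
⟦ term c e Q w ⟧ n k = c * shiftBy e (packingSeries Q (w ℕ.+ n)) k

⟦_⟧* : List Term → ℕ → ℕ → ℤ
⟦ []    ⟧* n k = + 0
⟦ t ∷ L ⟧* n k = ⟦ t ⟧ n k + ⟦ L ⟧* n k

⟦⟧*-++ : ∀ L L′ n k → ⟦ L ++ L′ ⟧* n k ≡ ⟦ L ⟧* n k + ⟦ L′ ⟧* n k
⟦⟧*-++ []      L′ n k = sym (ℤₚ.+-identityˡ _)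
⟦⟧*-++ (t ∷ L) L′ n k =
  trans (cong (λ z → ⟦ t ⟧ n k + z) (⟦⟧*-++ L L′ n k)) (sym (ℤₚ.+-assoc (⟦ t ⟧ n k) _ _))

SoundAt : ℕ → (Term → List Term) → Set
SoundAt n f = ∀ t k → ⟦ f t ⟧* n k ≡ ⟦ t ⟧ n k

⟦⟧*-concatMap : ∀ {n} f → SoundAt n f → ∀ L k → ⟦ concatMap f L ⟧* n k ≡ ⟦ L ⟧* n k
⟦⟧*-concatMap     f sound []      k = refl
⟦⟧*-concatMap {n} f sound (t ∷ L) k =
  trans (⟦⟧*-++ (f t) (concatMap f L) n k) (cong₂ _+_ (sound t k) (⟦⟧*-concatMap f sound L k))

SameMonomial : Term → Term → Set
SameMonomial t u = tExp t ≡ tExp u × frontier t ≡ frontier u × width t ≡ width u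

sameMonomial? : ∀ t u → Dec (SameMonomial t u)
sameMonomial? t u =
  tExp t ℕ.≟ tExp u ×-dec List-≡-dec (×-≡-dec ℕ._≟_ ℕ._≟_) (frontier t) (frontier u) ×-dec width t ℕ.≟ width u

insert : Term → List Term → List Term
insert t []      = t ∷ []
insert t (u ∷ L) with sameMonomial? t u
... | true  because _ = record u { coeff = coeff t + coeff u } ∷ L
... | false because _ = u ∷ insert t L

⟦⟧*-insert : ∀ t L n k → ⟦ insert t L ⟧* n k ≡ ⟦ t ⟧ n k + ⟦ L ⟧* n k
⟦⟧*-insert t [] n k = refl
⟦⟧*-insert t@(term c e Q w) (u@(term c′ _ _ _) ∷ L) n k with sameMonomial? t u
... | yes (refl , refl , refl) =
  trans (cong (_+ ⟦ L ⟧* n k) (ℤₚ.*-distribʳ-+ (shiftBy e (packingSeries Q (w ℕ.+ n)) k) c c′))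
        (ℤₚ.+-assoc (⟦ t ⟧ n k) _ _)
... | no _ =
  trans (cong (λ z → ⟦ u ⟧ n k + z) (⟦⟧*-insert t L n k)) (x∙yz≈y∙xz (⟦ u ⟧ n k) (⟦ t ⟧ n k) (⟦ L ⟧* n k))
  where open CommSemigroupProperties ℤₚ.+-commutativeSemigroup using (x∙yz≈y∙xz)

normalise : List Term → List Term
normalise []      = []
normalise (t ∷ L) = insert t (normalise L)

⟦⟧*-normalise : ∀ L n k → ⟦ normalise L ⟧* n k ≡ ⟦ L ⟧* n k
⟦⟧*-normalise []      n k = refl
⟦⟧*-normalise (t ∷ L) n k =
  trans (⟦⟧*-insert t (normalise L) n k) (cong (λ z → ⟦ t ⟧ n k + z) (⟦⟧*-normalise L n k))

rewriteWith : (Term → List Term) → List Term → List Term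
rewriteWith f L = normalise (concatMap f L)

⟦⟧*-rewriteWith : ∀ {n} f → SoundAt n f → ∀ L k → ⟦ rewriteWith f L ⟧* n k ≡ ⟦ L ⟧* n k
⟦⟧*-rewriteWith {n} f sound L k = trans (⟦⟧*-normalise (concatMap f L) n k) (⟦⟧*-concatMap f sound L k)

-- Deletion–contraction on the leading frontier squares accepted by sel; the fuel only
-- ensures termination, and the length of the frontier is always enough.
expand : (Pos → Bool) → ℕ → Term → List Term
expand sel zero    t                      = t ∷ []
expand sel (suc f) t@(term c e []      w) = t ∷ []
expand sel (suc f) t@(term c e (x ∷ Q) w) =
  if sel x then expand sel f (term c e Q w) ++ expand sel f (term c (suc e) (filterᵇ (disjointᵇ 4 x) Q) w)
           else t ∷ []

⟦⟧*-expand : ∀ sel n w → (∀ x → sel x ≡ true → filterᵇ (disjointᵇ 4 x) (grid (w ℕ.+ n)) ≡ grid (w ℕ.+ n)) →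
             ∀ f c e Q k → ⟦ expand sel f (term c e Q w) ⟧* n k ≡ ⟦ term c e Q w ⟧ n k
⟦⟧*-expand sel n w isolated zero    c e Q       k = ℤₚ.+-identityʳ _
⟦⟧*-expand sel n w isolated (suc f) c e []      k = ℤₚ.+-identityʳ _
⟦⟧*-expand sel n w isolated (suc f) c e (x ∷ Q) k with sel x in sel-x
... | false = ℤₚ.+-identityʳ _
... | true  = begin
  ⟦ expand sel f (term c e Q w) ++ expand sel f (term c (suc e) Q′ w) ⟧* n k
    ≡⟨ ⟦⟧*-++ (expand sel f (term c e Q w)) _ n k ⟩
  ⟦ expand sel f (term c e Q w) ⟧* n k + ⟦ expand sel f (term c (suc e) Q′ w) ⟧* n k
    ≡⟨ cong₂ _+_ (⟦⟧*-expand sel n w isolated f c e Q k) (⟦⟧*-expand sel n w isolated f c (suc e) Q′ k) ⟩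
  c * shiftBy e (G Q) k + c * shiftBy (suc e) (G Q′) k
    ≡⟨ sym (ℤₚ.*-distribˡ-+ c _ _) ⟩
  c * (shiftBy e (G Q) k + shiftBy (suc e) (G Q′) k)
    ≡⟨ cong (λ z → c * (shiftBy e (G Q) k + z)) (sym (shiftBy-suc e (G Q′) k)) ⟩
  c * (shiftBy e (G Q) k + shiftBy e (shiftBy 1 (G Q′)) k)
    ≡⟨ cong (c *_) (sym (shiftBy-+ e (G Q) (shiftBy 1 (G Q′)) k)) ⟩
  c * shiftBy e (λ k′ → G Q k′ + shiftBy 1 (G Q′) k′) k
    ≡⟨ cong (c *_) (shiftBy-cong e (λ k′ → sym (packingSeries-∷ x Q (w ℕ.+ n) (isolated x sel-x) k′)) k) ⟩
  c * shiftBy e (G (x ∷ Q)) k ∎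
  where
  open ≡-Reasoning
  G = λ Q → packingSeries Q (w ℕ.+ n)
  Q′ = filterᵇ (disjointᵇ 4 x) Q

expandColumn0 : Term → List Term
expandColumn0 t = expand inColumn0 (length (frontier t)) t

expandColumn0-sound : ∀ n → SoundAt n expandColumn0
expandColumn0-sound n (term c e Q w) =
  ⟦⟧*-expand inColumn0 n w (λ x x∈column0 → filter-column0-grid x x∈column0 (w ℕ.+ n)) (length Q) c e Q

expandEmptyGrid : Term → List Term
expandEmptyGrid t@(term c e Q zero)    = expand (λ _ → true) (length Q) t
expandEmptyGrid t@(term c e Q (suc w)) = t ∷ []

expandEmptyGrid-sound : SoundAt 0 expandEmptyGrid
expandEmptyGrid-sound (term c e Q zero)      = ⟦⟧*-expand (λ _ → true) 0 0 (λ _ _ → refl) (length Q) c e Q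
expandEmptyGrid-sound (term c e Q (suc w)) k = ℤₚ.+-identityʳ _

shiftable : Term → Bool
shiftable (term _ _ Q w) = not (w ℕ.≡ᵇ 0) ∧ all (not ∘ inColumn0) Q

shiftLeft : Term → Term
shiftLeft (term c e Q w) = term c e (map left Q ++ column 3) (ℕ.pred w)

⟦⟧*-map-shiftLeft : ∀ n L → all shiftable L ≡ true → ∀ k → ⟦ map shiftLeft L ⟧* n k ≡ ⟦ L ⟧* n k
⟦⟧*-map-shiftLeft n [] _ k = refl
⟦⟧*-map-shiftLeft n (term c e Q (suc w) ∷ L) h k with all (not ∘ inColumn0) Q in Q-shiftable
... | true = cong₂ _+_
  (cong (c *_) (shiftBy-cong e (λ k′ → sym (packingSeries-advance Q (w ℕ.+ n) Q-shiftable k′)) k))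
  (⟦⟧*-map-shiftLeft n L h k)

advance : Term → List Term
advance t@(term c e Q zero)    = t ∷ []
advance t@(term c e Q (suc w)) = if all shiftable ts then map shiftLeft ts else t ∷ []
  where ts = expandColumn0 t

advance-sound : ∀ n → SoundAt n advance
advance-sound n (term c e Q zero)      k = ℤₚ.+-identityʳ _
advance-sound n t@(term c e Q (suc w)) k with all shiftable (expandColumn0 t) in ts-shiftable
... | true  = trans (⟦⟧*-map-shiftLeft n (expandColumn0 t) ts-shiftable k) (expandColumn0-sound n t k)
... | false = ℤₚ.+-identityʳ _

advanceAll : ℕ → List Term → List Term
advanceAll zero    L = L
advanceAll (suc i) L = advanceAll i (rewriteWith advance L)

⟦⟧*-advanceAll : ∀ n i L k → ⟦ advanceAll i L ⟧* n k ≡ ⟦ L ⟧* n k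
⟦⟧*-advanceAll n zero    L k = refl
⟦⟧*-advanceAll n (suc i) L k =
  trans (⟦⟧*-advanceAll n i (rewriteWith advance L) k) (⟦⟧*-rewriteWith advance (advance-sound n) L k)

isZero : ℤ → Bool
isZero (+ zero) = true
isZero _        = false

⟦⟧*-vanishing : ∀ L n k → all (isZero ∘ coeff) L ≡ true → ⟦ L ⟧* n k ≡ + 0
⟦⟧*-vanishing []                         n k _  = refl
⟦⟧*-vanishing (term (+ zero) e Q w ∷ L)  n k h  = trans (ℤₚ.+-identityˡ _) (⟦⟧*-vanishing L n k h)
⟦⟧*-vanishing (term (+ suc _) e Q w ∷ L) n k ()
⟦⟧*-vanishing (term -[1+ _ ] e Q w ∷ L)  n k ()

negate : List Term → List Term
negate = map (λ t → record t { coeff = - coeff t })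

⟦⟧*-negate : ∀ L n k → ⟦ negate L ⟧* n k ≡ - ⟦ L ⟧* n k
⟦⟧*-negate []                     n k = refl
⟦⟧*-negate (t@(term c e Q w) ∷ L) n k =
  trans (cong₂ _+_ (sym (ℤₚ.neg-distribˡ-* c _)) (⟦⟧*-negate L n k)) (sym (ℤₚ.neg-distrib-+ (⟦ t ⟧ n k) _))

⟦⟧*-≡ : ∀ L L′ n k → all (isZero ∘ coeff) (normalise (L ++ negate L′)) ≡ true →
        ⟦ L ⟧* n k ≡ ⟦ L′ ⟧* n k
⟦⟧*-≡ L L′ n k cancels = ℤₚ.i-j≡0⇒i≡j _ _ (begin
  ⟦ L ⟧* n k - ⟦ L′ ⟧* n k            ≡⟨ cong (λ z → ⟦ L ⟧* n k + z) (sym (⟦⟧*-negate L′ n k)) ⟩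
  ⟦ L ⟧* n k + ⟦ negate L′ ⟧* n k     ≡⟨ sym (⟦⟧*-++ L (negate L′) n k) ⟩
  ⟦ L ++ negate L′ ⟧* n k             ≡⟨ sym (⟦⟧*-normalise (L ++ negate L′) n k) ⟩
  ⟦ normalise (L ++ negate L′) ⟧* n k ≡⟨ ⟦⟧*-vanishing (normalise (L ++ negate L′)) n k cancels ⟩
  + 0                                 ∎)
  where open ≡-Reasoning

-- The generating function of 8 × m tilings

F₈₄-as-packingSeries : ∀ m → F₈₄ m ≗ packingSeries [] (suc m ∸ 4 ℕ.+ 0)
F₈₄-as-packingSeries m k =
  cong +_ (trans (T-as-packings m k) (cong (λ c → packings 4 (grid c) k) (sym (ℕₚ.+-identityʳ (suc m ∸ 4)))))

productTerms : List (ℤ × ℕ × ℕ) → ℕ → List Term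
productTerms []                m = []
productTerms ((c , a , b) ∷ P) m =
  if a ℕ.≤ᵇ m then term c b [] (suc (m ∸ a) ∸ 4) ∷ productTerms P m else productTerms P m

productTerms-sound : ∀ P m k → polyAction P F₈₄ m k ≡ ⟦ productTerms P m ⟧* 0 k
productTerms-sound []                m k = refl
productTerms-sound ((c , a , b) ∷ P) m k with a ℕ.≤ᵇ m
... | true  = cong₂ _+_ (cong (c *_) (shiftBy-cong b (F₈₄-as-packingSeries (m ∸ a)) k)) (productTerms-sound P m k)
... | false = trans (ℤₚ.+-identityˡ _) (productTerms-sound P m k)

coefficientTerms : List (ℤ × ℕ × ℕ) → ℕ → List Term
coefficientTerms []                m = []
coefficientTerms ((c , a , b) ∷ P) m =
  if ⌊ a ℕ.≟ m ⌋ then term c b [] 0 ∷ coefficientTerms P m else coefficientTerms P m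

coefficientTerms-sound : ∀ P m k → poly P m k ≡ ⟦ coefficientTerms P m ⟧* 0 k
coefficientTerms-sound []                m k = refl
coefficientTerms-sound ((c , a , b) ∷ P) m k with ⌊ a ℕ.≟ m ⌋
... | true  = cong₂ _+_ (indicator b k) (coefficientTerms-sound P m k)
  where
  indicator : ∀ b k → (if ⌊ b ℕ.≟ k ⌋ then c else + 0) ≡ ⟦ term c b [] 0 ⟧ 0 k
  indicator zero    zero    = sym (ℤₚ.*-identityʳ c)
  indicator zero    (suc k) = sym (ℤₚ.*-zeroʳ c)
  indicator (suc b) zero    = sym (ℤₚ.*-zeroʳ c)
  indicator (suc b) (suc k) = trans (cong (λ p → if p then c else + 0) (⌊suc≟suc⌋ b k)) (indicator b k)
... | false = trans (ℤₚ.+-identityˡ _) (coefficientTerms-sound P m k)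

widen : ℕ → Term → Term
widen n (term c e Q w) = term c e Q (w ℕ.+ n)

⟦⟧*-widen : ∀ n L k → ⟦ map (widen n) L ⟧* 0 k ≡ ⟦ L ⟧* n k
⟦⟧*-widen n []                 k = refl
⟦⟧*-widen n (term c e Q w ∷ L) k =
  cong₂ _+_ (cong (λ c′ → c * shiftBy e (packingSeries Q c′) k) (ℕₚ.+-identityʳ (w ℕ.+ n))) (⟦⟧*-widen n L k)

denominator numerator : List (ℤ × ℕ × ℕ)
denominator = (+ 1 , 0 , 0) ∷ (- + 1 , 1 , 0) ∷ (- + 1 , 2 , 1)
            ∷ (- + 4 , 4 , 1) ∷ (- + 2 , 4 , 2) ∷ (- + 1 , 5 , 2)
            ∷ (+ 3 , 6 , 2) ∷ (+ 2 , 6 , 3) ∷ (+ 3 , 7 , 2) ∷ (+ 2 , 7 , 3)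
            ∷ (+ 3 , 8 , 3) ∷ (+ 1 , 8 , 4) ∷ (- + 3 , 10 , 4)
            ∷ (- + 1 , 10 , 5) ∷ []
numerator = (+ 1 , 0 , 0) ∷ (- + 1 , 2 , 1) ∷ (- + 1 , 3 , 1) ∷ (- + 1 , 4 , 2) ∷ (+ 1 , 6 , 3) ∷ []

Den⊛F₈₄-as-terms : ∀ m k → (Den ⊛ F₈₄) m k ≡ ⟦ productTerms denominator m ⟧* 0 k
Den⊛F₈₄-as-terms m k = trans (poly-⊛ denominator F₈₄ m k) (productTerms-sound denominator m k)

largeReduction : List Term
largeReduction = rewriteWith expandColumn0 (advanceAll 10 (productTerms denominator 13))

smallReduction : ℕ → List Term
smallReduction m = rewriteWith expandEmptyGrid (advanceAll 10 (productTerms denominator m))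

-- Den has z-degree 10, so productTerms denominator (13 + n) computes to
-- map (widen n) (productTerms denominator 13); likewise Num (13 + n) k computes to + 0.
theorem-large : ∀ n k → (Den ⊛ F₈₄) (13 ℕ.+ n) k ≡ Num (13 ℕ.+ n) k
theorem-large n k = begin
  (Den ⊛ F₈₄) (13 ℕ.+ n) k              ≡⟨ Den⊛F₈₄-as-terms (13 ℕ.+ n) k ⟩
  ⟦ map (widen n) initial ⟧* 0 k        ≡⟨ ⟦⟧*-widen n initial k ⟩
  ⟦ initial ⟧* n k                      ≡⟨ sym (⟦⟧*-advanceAll n 10 initial k) ⟩
  ⟦ advanceAll 10 initial ⟧* n k
    ≡⟨ sym (⟦⟧*-rewriteWith expandColumn0 (expandColumn0-sound n) (advanceAll 10 initial) k) ⟩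
  ⟦ largeReduction ⟧* n k               ≡⟨ ⟦⟧*-vanishing largeReduction n k refl ⟩
  + 0                                   ∎
  where
  open ≡-Reasoning
  initial = productTerms denominator 13

theorem-small : ∀ m k → all (isZero ∘ coeff) (normalise (smallReduction m ++ negate (coefficientTerms numerator m))) ≡ true
                      → (Den ⊛ F₈₄) m k ≡ Num m k
theorem-small m k verified = begin
  (Den ⊛ F₈₄) m k                       ≡⟨ Den⊛F₈₄-as-terms m k ⟩
  ⟦ initial ⟧* 0 k                      ≡⟨ sym (⟦⟧*-advanceAll 0 10 initial k) ⟩
  ⟦ advanceAll 10 initial ⟧* 0 k
    ≡⟨ sym (⟦⟧*-rewriteWith expandEmptyGrid expandEmptyGrid-sound (advanceAll 10 initial) k) ⟩
  ⟦ smallReduction m ⟧* 0 k             ≡⟨ ⟦⟧*-≡ (smallReduction m) (coefficientTerms numerator m) 0 k verified ⟩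
  ⟦ coefficientTerms numerator m ⟧* 0 k ≡⟨ sym (coefficientTerms-sound numerator m k) ⟩
  Num m k                               ∎
  where
  open ≡-Reasoning
  initial = productTerms denominator m

mainTheorem11 : (m k : ℕ) → (Den ⊛ F₈₄) m k ≡ Num m k
mainTheorem11 0  k = theorem-small 0  k refl
mainTheorem11 1  k = theorem-small 1  k refl
mainTheorem11 2  k = theorem-small 2  k refl
mainTheorem11 3  k = theorem-small 3  k refl
mainTheorem11 4  k = theorem-small 4  k refl
mainTheorem11 5  k = theorem-small 5  k refl
mainTheorem11 6  k = theorem-small 6  k refl
mainTheorem11 7  k = theorem-small 7  k refl
mainTheorem11 8  k = theorem-small 8  k refl
mainTheorem11 9  k = theorem-small 9  k refl
mainTheorem11 10 k = theorem-small 10 k refl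
mainTheorem11 11 k = theorem-small 11 k refl
mainTheorem11 12 k = theorem-small 12 k refl
mainTheorem11 (suc (suc (suc (suc (suc (suc (suc (suc (suc (suc (suc (suc (suc n))))))))))))) k = theorem-large n k
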